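{- Let $d\ge3$. There is no constant $C=C(d)>0$ such that for every field $\mathbb{K}$, all positive integers $n_1,\dots,n_d$ and every nonzero linear subspace $\mathsf{W}\subseteq\mathbb{K}^{n_1}\otimes\cdots\otimes\mathbb{K}^{n_d}$, \[ \mathrm{SR}_{\mathbb{K}}(\mathsf{W})\le C\,\mathrm{SR}_{1,\mathbb{K}}(\mathsf{W}). \]
   Context: For a linear subspace $\mathsf{W}\subseteq\mathbb{K}^{n_1}\otimes\cdots\otimes\mathbb{K}^{n_d}$, $\mathrm{SR}_{\mathbb{K}}(\mathsf{W})=\min\{\sum_{i=1}^d\operatorname{codim}(\mathsf{U}_i):\mathsf{U}_i\subseteq(\mathbb{K}^{n_i})^*,\ \langle T,u_1\otimes\cdots\otimes u_d\rangle=0\ \forall T\in\mathsf{W},u_i\in\mathsf{U}_i\}$ (full contraction), and for $1\le k\le\dim\mathsf{W}$, $\mathrm{SR}_{k,\mathbb{K}}(\mathsf{W})=\max\{\mathrm{SR}_{\mathbb{K}}(\mathsf{V}):\mathsf{V}\subseteq\mathsf{W},\ \dim\mathsf{V}=k\}$. -}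

module Defs where

open import Level using (0ℓ)
open import Data.Nat as ℕ using (ℕ; zero; suc; _∸_)
open import Data.Fin using (Fin; zero; suc)
open import Data.Product using (Σ; ∃; _×_; _,_)
open import Relation.Nullary using (¬_)
open import Algebra.Bundles using (CommutativeRing)

record Field : Set₁ where
  field
    commRing  : CommutativeRing 0ℓ 0ℓ
  open CommutativeRing commRing public
  field
    0≉1       : ¬ (0# ≈ 1#)
    inverse   : ∀ x → ¬ (x ≈ 0#) → ∃ λ y → x * y ≈ 1#

module _ (K : Field) where
  open Field K using (Carrier; _≈_; _+_; _*_; 0#; 1#)

  sumFin : (n : ℕ) → (Fin n → Carrier) → Carrier
  sumFin zero    f = 0#
  sumFin (suc n) f = f zero + sumFin n (λ j → f (suc j))

  prodFin : (d : ℕ) → (Fin d → Carrier) → Carrier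
  prodFin zero    f = 1#
  prodFin (suc d) f = f zero * prodFin d (λ k → f (suc k))

  -- vectors in K^n (also used for dual vectors, via the coordinate pairing)
  Vect : ℕ → Set
  Vect n = Fin n → Carrier

  MultiIndex : (d : ℕ) → (Fin d → ℕ) → Set
  MultiIndex d n = (k : Fin d) → Fin (n k)

  Tensor : (d : ℕ) → (Fin d → ℕ) → Set
  Tensor d n = MultiIndex d n → Carrier

  consMI : ∀ {d} {n : Fin (suc d) → ℕ} → Fin (n zero) →
           MultiIndex d (λ k → n (suc k)) → MultiIndex (suc d) n
  consMI j ι zero    = j
  consMI j ι (suc k) = ι k

  sumMI : (d : ℕ) (n : Fin d → ℕ) → (MultiIndex d n → Carrier) → Carrier
  sumMI zero    n f = f (λ ())
  sumMI (suc d) n f =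
    sumFin (n zero) (λ j → sumMI d (λ k → n (suc k)) (λ ι → f (consMI j ι)))

  contract : (d : ℕ) (n : Fin d → ℕ) → Tensor d n → ((k : Fin d) → Vect (n k)) → Carrier
  contract d n T u = sumMI d n (λ ι → T ι * prodFin d (λ k → u k (ι k)))

  linCombVec : ∀ {n} (m : ℕ) → (Fin m → Vect n) → Vect m → Vect n
  linCombVec m b c i = sumFin m (λ j → c j * b j i)

  linCombTensor : ∀ {d n} (m : ℕ) → (Fin m → Tensor d n) → Vect m → Tensor d n
  linCombTensor m T a ι = sumFin m (λ j → a j * T j ι)

  LinIndep : ∀ {n} (r : ℕ) → (Fin r → Vect n) → Set
  LinIndep {n} r b = ∀ c → (∀ i → linCombVec r b c i ≈ 0#) → ∀ j → c j ≈ 0#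

  InSpanVec : ∀ {n} (r : ℕ) → (Fin r → Vect n) → Vect n → Set
  InSpanVec {n} r b u = ∃ λ c → ∀ i → u i ≈ linCombVec r b c i

  InSpanTensor : ∀ {d n} (m : ℕ) → (Fin m → Tensor d n) → Tensor d n → Set
  InSpanTensor m T S = ∃ λ a → ∀ ι → S ι ≈ linCombTensor m T a ι

  IsZeroTensor : ∀ {d n} → Tensor d n → Set
  IsZeroTensor T = ∀ ι → T ι ≈ 0#

  -- A subspace W ⊆ K^{n_1}⊗⋯⊗K^{n_d} is given as the span of a finite
  -- family T_1,…,T_m of tensors.  A subspace U_k ⊆ (K^{n_k})^* is given by a
  -- basis (a linearly independent family of r_k vectors), so that
  -- codim U_k = n_k ∸ r_k.
  SRLe : (d : ℕ) (n : Fin d → ℕ) (m : ℕ) → (Fin m → Tensor d n) → ℕ → Set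
  SRLe d n m T s =
    Σ (Fin d → ℕ) λ r →
    Σ ((k : Fin d) → Fin (r k) → Vect (n k)) λ B →
      (∀ k → LinIndep (r k) (B k))
    × ℕ._≤_ (sumℕ d (λ k → n k ∸ r k)) s
    × (∀ (S : Tensor d n) → InSpanTensor m T S →
       ∀ (u : (k : Fin d) → Vect (n k)) → (∀ k → InSpanVec (r k) (B k) (u k)) →
       contract d n S u ≈ 0#)
    where
    sumℕ : (d : ℕ) → (Fin d → ℕ) → ℕ
    sumℕ zero    f = 0
    sumℕ (suc d) f = f zero ℕ.+ sumℕ d (λ k → f (suc k))

  IsSR : (d : ℕ) (n : Fin d → ℕ) (m : ℕ) → (Fin m → Tensor d n) → ℕ → Set
  IsSR d n m T s = SRLe d n m T s × (∀ s' → SRLe d n m T s' → ℕ._≤_ s s')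

  -- IsSR1 d n m T t : t = SR_{1,K}(W) for W = span(T), i.e. the maximum of
  -- SR_K(V) over 1-dimensional V ⊆ W, i.e. V = span(S) with S ∈ W, S ≠ 0.
  IsSR1 : (d : ℕ) (n : Fin d → ℕ) (m : ℕ) → (Fin m → Tensor d n) → ℕ → Set
  IsSR1 d n m T t =
    (∃ λ (S : Tensor d n) → InSpanTensor m T S × ¬ IsZeroTensor S
                           × IsSR d n 1 (λ _ → S) t)
    × (∀ (S : Tensor d n) → InSpanTensor m T S → ¬ IsZeroTensor S →
       ∀ t' → IsSR d n 1 (λ _ → S) t' → ℕ._≤_ t' t)

  NonzeroSpan : ∀ {d n} (m : ℕ) → (Fin m → Tensor d n) → Set
  NonzeroSpan m T = ¬ (∀ j → IsZeroTensor (T j))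

{-# OPTIONS --safe #-}
-- Work over ℚ with N = C + 1.  Call a tensor M on d − 1 ≥ 2 factors robust if it does not
-- vanish on any product of subspaces of total codimension < N.  Tensor products of identity
-- matrices I_N are robust, and so is the N × N × N² tensor δ(combine(i, j), k), which covers an
-- odd number of factors: two subspaces of ℚ^P whose dimensions sum to more than P are never
-- orthogonal, as the dot product is anisotropic over ℚ.  Let W = span{e_j ⊗ M}.  Cutting the
-- first factor down to 0 gives SR(W) ≤ N, and any cheaper choice of subspaces leaves a covector
-- u₁ with u₁(e_j) ≠ 0 together with covectors on which M is nonzero, so SR(W) = N.  Every
-- nonzero element of W is a ⊗ M, annihilated by cutting the first factor to the hyperplane a^⊥,
-- so SR₁(W) = 1; and N ≤ C · 1 is false.
module Submission where

open import Defs
open import Level using (0ℓ)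
open import Data.Nat as ℕ using (ℕ; zero; suc; _∸_; _≤_; _<_; _>_; z≤n; s≤s)
import Data.Nat.Properties as ℕₚ
open import Data.Fin as Fin using (Fin; zero; suc; punchIn; _↑ˡ_; _↑ʳ_; combine; splitAt; quotient; remainder)
import Data.Fin.Properties as Finₚ
open import Data.Rational as ℚ using (ℚ; 0ℚ; 1ℚ; _+_; _*_; -_; _-_; 1/_)
import Data.Rational.Properties as ℚₚ
open import Data.Product using (Σ; ∃; ∃₂; _×_; _,_; proj₁; proj₂)
open import Data.Unit using (⊤; tt)
open import Data.Sum using (inj₁; inj₂)
open import Data.Vec.Functional using ([]; _∷_; _++_; insertAt)
open import Data.Vec.Functional.Properties using (insertAt-lookup; insertAt-punchIn; lookup-++ˡ; lookup-++ʳ)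
open import Function using (_∘_)
open import Relation.Nullary using (¬_; yes; no; contradiction)
open import Relation.Binary using (tri<; tri≈; tri>)
open import Relation.Nullary.Decidable using (dec⇒maybe)
open import Relation.Binary.PropositionalEquality
open import Tactic.RingSolver using (solve-∀)
open import Data.Nat.Tactic.RingSolver renaming (solve-∀ to ℕ-solve-∀)
open import Tactic.RingSolver.Core.AlmostCommutativeRing using (AlmostCommutativeRing; fromCommutativeRing)

ℚ-field : Field
ℚ-field = record
  { commRing = ℚₚ.+-*-commutativeRing
  ; 0≉1      = λ ()
  ; inverse  = λ x x≢0 → let instance _ = ℚ.≢-nonZero x≢0 in 1/ x , ℚₚ.*-inverseʳ x
  }

ℚ-ring : AlmostCommutativeRing 0ℓ 0ℓ
ℚ-ring = fromCommutativeRing ℚₚ.+-*-commutativeRing (λ x → dec⇒maybe (0ℚ ℚₚ.≟ x))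

*-cancelˡ-≡0 : ∀ {a b} → a ≢ 0ℚ → a * b ≡ 0ℚ → b ≡ 0ℚ
*-cancelˡ-≡0 {a} {b} a≢0 ab≡0 = begin
  b               ≡⟨ sym (ℚₚ.*-identityˡ b) ⟩
  1ℚ * b          ≡⟨ cong (_* b) (sym (ℚₚ.*-inverseˡ a)) ⟩
  (1/ a * a) * b  ≡⟨ ℚₚ.*-assoc (1/ a) a b ⟩
  1/ a * (a * b)  ≡⟨ cong (1/ a *_) ab≡0 ⟩
  1/ a * 0ℚ       ≡⟨ ℚₚ.*-zeroʳ (1/ a) ⟩
  0ℚ              ∎
  where
  open ≡-Reasoning
  instance _ = ℚ.≢-nonZero a≢0

*-≢0 : ∀ {a b} → a ≢ 0ℚ → b ≢ 0ℚ → a * b ≢ 0ℚ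
*-≢0 a≢0 b≢0 = b≢0 ∘ *-cancelˡ-≡0 a≢0

square-pos : ∀ {x} → x ≢ 0ℚ → 0ℚ ℚ.< x * x
square-pos {x} x≢0 with ℚₚ.<-cmp x 0ℚ
... | tri< x<0 _ _ = let instance _ = ℚ.negative x<0 in ℚₚ.positive⁻¹ (x * x) {{ℚₚ.neg*neg⇒pos x x}}
... | tri≈ _ x≡0 _ = contradiction x≡0 x≢0
... | tri> _ _ x>0 = let instance _ = ℚ.positive x>0 in ℚₚ.positive⁻¹ (x * x) {{ℚₚ.pos*pos⇒pos x x}}

square-nonneg : ∀ x → 0ℚ ℚ.≤ x * x
square-nonneg x with x ℚₚ.≟ 0ℚ
... | yes refl = ℚₚ.≤-refl
... | no  x≢0  = ℚₚ.<⇒≤ (square-pos x≢0)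

-- Finite sums

∑ : (n : ℕ) → (Fin n → ℚ) → ℚ
∑ = sumFin ℚ-field

∑-cong : ∀ n {f g : Fin n → ℚ} → f ≗ g → ∑ n f ≡ ∑ n g
∑-cong zero    f≗g = refl
∑-cong (suc n) f≗g = cong₂ _+_ (f≗g zero) (∑-cong n (f≗g ∘ suc))

∑-zero : ∀ n → ∑ n (λ _ → 0ℚ) ≡ 0ℚ
∑-zero zero    = refl
∑-zero (suc n) = trans (cong (0ℚ +_) (∑-zero n)) (ℚₚ.+-identityˡ 0ℚ)

∑-distrib-+ : ∀ n (f g : Fin n → ℚ) → ∑ n (λ i → f i + g i) ≡ ∑ n f + ∑ n g
∑-distrib-+ zero    f g = sym (ℚₚ.+-identityˡ 0ℚ)
∑-distrib-+ (suc n) f g =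
  trans (cong (f zero + g zero +_) (∑-distrib-+ n (f ∘ suc) (g ∘ suc)))
        (+-interchange (f zero) (g zero) (∑ n (f ∘ suc)) (∑ n (g ∘ suc)))
  where
  +-interchange : ∀ a b c d → (a + b) + (c + d) ≡ (a + c) + (b + d)
  +-interchange = solve-∀ ℚ-ring

*-distribˡ-∑ : ∀ n c (f : Fin n → ℚ) → c * ∑ n f ≡ ∑ n (λ i → c * f i)
*-distribˡ-∑ zero    c f = ℚₚ.*-zeroʳ c
*-distribˡ-∑ (suc n) c f =
  trans (ℚₚ.*-distribˡ-+ c (f zero) _) (cong (c * f zero +_) (*-distribˡ-∑ n c (f ∘ suc)))

*-distribʳ-∑ : ∀ n c (f : Fin n → ℚ) → ∑ n f * c ≡ ∑ n (λ i → f i * c)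
*-distribʳ-∑ n c f =
  trans (ℚₚ.*-comm _ c) (trans (*-distribˡ-∑ n c f) (∑-cong n (λ i → ℚₚ.*-comm c (f i))))

∑-comm : ∀ m n (f : Fin m → Fin n → ℚ) →
         ∑ m (λ i → ∑ n (f i)) ≡ ∑ n (λ j → ∑ m (λ i → f i j))
∑-comm zero    n f = sym (∑-zero n)
∑-comm (suc m) n f =
  trans (cong (∑ n (f zero) +_) (∑-comm m n (f ∘ suc)))
        (sym (∑-distrib-+ n (f zero) (λ j → ∑ m (λ i → f (suc i) j))))

∑-↑ : ∀ m n (f : Fin (m ℕ.+ n) → ℚ) → ∑ (m ℕ.+ n) f ≡ ∑ m (f ∘ (_↑ˡ n)) + ∑ n (f ∘ (m ↑ʳ_))
∑-↑ zero    n f = sym (ℚₚ.+-identityˡ _)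
∑-↑ (suc m) n f = trans (cong (f zero +_) (∑-↑ m n (f ∘ suc))) (sym (ℚₚ.+-assoc (f zero) _ _))

∑-combine : ∀ m n (f : Fin (m ℕ.* n) → ℚ) → ∑ (m ℕ.* n) f ≡ ∑ m (λ i → ∑ n (λ j → f (combine i j)))
∑-combine zero    n f = refl
∑-combine (suc m) n f = trans (∑-↑ n (m ℕ.* n) f) (cong (∑ n (f ∘ (_↑ˡ (m ℕ.* n))) +_) (∑-combine m n (f ∘ (n ↑ʳ_))))

∑-punchIn : ∀ n (i : Fin (suc n)) (f : Fin (suc n) → ℚ) → ∑ (suc n) f ≡ f i + ∑ n (f ∘ punchIn i)
∑-punchIn n       zero    f = refl
∑-punchIn (suc n) (suc i) f =
  trans (cong (f zero +_) (∑-punchIn n i (f ∘ suc)))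
        (+-left-comm (f zero) (f (suc i)) _)
  where
  +-left-comm : ∀ a b c → a + (b + c) ≡ b + (a + c)
  +-left-comm = solve-∀ ℚ-ring

-- Linear algebra over ℚ

δ : ∀ {n} → Fin n → Fin n → ℚ
δ zero    zero    = 1ℚ
δ zero    (suc _) = 0ℚ
δ (suc _) zero    = 0ℚ
δ (suc i) (suc j) = δ i j

δ-diag : ∀ {n} (i : Fin n) → δ i i ≡ 1ℚ
δ-diag zero    = refl
δ-diag (suc i) = δ-diag i

δ-off : ∀ {n} {i j : Fin n} → i ≢ j → δ i j ≡ 0ℚ
δ-off {i = zero}  {zero}  i≢j = contradiction refl i≢j
δ-off {i = zero}  {suc j} i≢j = refl
δ-off {i = suc i} {zero}  i≢j = refl
δ-off {i = suc i} {suc j} i≢j = δ-off (i≢j ∘ cong suc)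

δ-sym : ∀ {n} (i j : Fin n) → δ i j ≡ δ j i
δ-sym zero    zero    = refl
δ-sym zero    (suc j) = refl
δ-sym (suc i) zero    = refl
δ-sym (suc i) (suc j) = δ-sym i j

δ-punchIn : ∀ {n} (i : Fin (suc n)) (j k : Fin n) → δ (punchIn i j) (punchIn i k) ≡ δ j k
δ-punchIn i j k with j Fin.≟ k
... | yes refl = trans (δ-diag (punchIn i j)) (sym (δ-diag j))
... | no  j≢k  = trans (δ-off (j≢k ∘ Finₚ.punchIn-injective i j k)) (sym (δ-off j≢k))

∑-δ : ∀ n (i : Fin n) (f : Fin n → ℚ) → ∑ n (λ j → δ i j * f j) ≡ f i
∑-δ (suc n) zero    f =
  trans (cong₂ _+_ (ℚₚ.*-identityˡ (f zero)) (trans (∑-cong n (ℚₚ.*-zeroˡ ∘ f ∘ suc)) (∑-zero n)))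
        (ℚₚ.+-identityʳ (f zero))
∑-δ (suc n) (suc i) f =
  trans (cong₂ _+_ (ℚₚ.*-zeroˡ (f zero)) (∑-δ n i (f ∘ suc))) (ℚₚ.+-identityˡ (f (suc i)))

∑-δ′ : ∀ n (i : Fin n) (f : Fin n → ℚ) → ∑ n (λ j → f j * δ j i) ≡ f i
∑-δ′ n i f = trans (∑-cong n (λ j → trans (ℚₚ.*-comm (f j) _) (cong (_* f j) (δ-sym j i)))) (∑-δ n i f)

dot : ∀ {n} → (Fin n → ℚ) → (Fin n → ℚ) → ℚ
dot {n} x y = ∑ n (λ i → x i * y i)

dot-δ : ∀ {n} (x : Fin n → ℚ) (i : Fin n) → dot x (δ i) ≡ x i
dot-δ {n} x i = trans (∑-cong n (λ j → cong (x j *_) (δ-sym i j))) (∑-δ′ n i x)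

dot-self-nonneg : ∀ {n} (x : Fin n → ℚ) → 0ℚ ℚ.≤ dot x x
dot-self-nonneg {zero}  x = ℚₚ.≤-refl
dot-self-nonneg {suc n} x = ℚₚ.+-mono-≤ (square-nonneg (x zero)) (dot-self-nonneg (x ∘ suc))

dot-self≡0 : ∀ {n} (x : Fin n → ℚ) → dot x x ≡ 0ℚ → ∀ i → x i ≡ 0ℚ
dot-self≡0 {suc n} x xx≡0 i with x zero ℚₚ.≟ 0ℚ
... | no x₀≢0 =
  contradiction (sym xx≡0) (ℚₚ.<⇒≢ (ℚₚ.+-mono-<-≤ (square-pos x₀≢0) (dot-self-nonneg (x ∘ suc))))
dot-self≡0 {suc n} x xx≡0 zero    | yes x₀≡0 = x₀≡0
dot-self≡0 {suc n} x xx≡0 (suc i) | yes x₀≡0 = dot-self≡0 (x ∘ suc) tail≡0 i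
  where
  tail≡0 : dot (x ∘ suc) (x ∘ suc) ≡ 0ℚ
  tail≡0 = begin
    dot (x ∘ suc) (x ∘ suc)                    ≡⟨ sym (ℚₚ.+-identityˡ _) ⟩
    0ℚ + dot (x ∘ suc) (x ∘ suc)               ≡⟨ cong (_+ dot (x ∘ suc) (x ∘ suc)) (sym x₀²≡0) ⟩
    x zero * x zero + dot (x ∘ suc) (x ∘ suc)  ≡⟨ xx≡0 ⟩
    0ℚ                                         ∎
    where
    open ≡-Reasoning
    x₀²≡0 : x zero * x zero ≡ 0ℚ
    x₀²≡0 = trans (cong₂ _*_ x₀≡0 x₀≡0) (ℚₚ.*-zeroˡ 0ℚ)

δ-independent : ∀ n → LinIndep ℚ-field n δ
δ-independent n c c-rel i = trans (sym (∑-δ′ n i c)) (c-rel i)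

single-independent : ∀ {P} (v : Fin P → ℚ) i → v i ≢ 0ℚ → LinIndep ℚ-field 1 (λ _ → v)
single-independent v i vi≢0 c c-rel zero =
  *-cancelˡ-≡0 vi≢0 (trans (ℚₚ.*-comm (v i) (c zero)) (trans (sym (ℚₚ.+-identityʳ (c zero * v i))) (c-rel i)))

independent⇒nonzero : ∀ {P} r (B : Fin r → Fin P → ℚ) → LinIndep ℚ-field r B → ∀ j → ¬ (∀ i → B j i ≡ 0ℚ)
independent⇒nonzero r B B-indep j Bj≡0 =
  ℚₚ.1≢0 (trans (sym (δ-diag j)) (B-indep (δ j) (λ i → trans (∑-δ r j (λ l → B l i)) (Bj≡0 i)) j))

member-inSpanVec : ∀ {P} r (B : Fin r → Fin P → ℚ) j → InSpanVec ℚ-field r B (B j)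
member-inSpanVec r B j = δ j , λ i → sym (∑-δ r j (λ l → B l i))

dot-comm : ∀ {n} (x y : Fin n → ℚ) → dot x y ≡ dot y x
dot-comm {n} x y = ∑-cong n (λ i → ℚₚ.*-comm (x i) (y i))

dot-linComb : ∀ {P} q (x : Fin P → ℚ) (D : Fin q → Fin P → ℚ) β →
              dot x (linCombVec ℚ-field q D β) ≡ ∑ q (λ l → β l * dot x (D l))
dot-linComb {P} q x D β = begin
  ∑ P (λ i → x i * ∑ q (λ l → β l * D l i))      ≡⟨ ∑-cong P (λ i → *-distribˡ-∑ q (x i) _) ⟩
  ∑ P (λ i → ∑ q (λ l → x i * (β l * D l i)))    ≡⟨ ∑-comm P q _ ⟩
  ∑ q (λ l → ∑ P (λ i → x i * (β l * D l i)))    ≡⟨ ∑-cong q (λ l → ∑-cong P (λ i → left-comm (x i) (β l) (D l i))) ⟩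
  ∑ q (λ l → ∑ P (λ i → β l * (x i * D l i)))    ≡⟨ ∑-cong q (λ l → sym (*-distribˡ-∑ P (β l) _)) ⟩
  ∑ q (λ l → β l * dot x (D l))                  ∎
  where
  open ≡-Reasoning
  left-comm : ∀ a b c → a * (b * c) ≡ b * (a * c)
  left-comm = solve-∀ ℚ-ring

span-orthogonal : ∀ {P} r (B : Fin r → Fin P → ℚ) (x : Fin P → ℚ) → (∀ j → dot x (B j) ≡ 0ℚ) →
                  ∀ {u} → InSpanVec ℚ-field r B u → dot x u ≡ 0ℚ
span-orthogonal {P} r B x x⊥B {u} (c , u≡Bc) = begin
  dot x u                              ≡⟨ ∑-cong P (λ i → cong (x i *_) (u≡Bc i)) ⟩
  dot x (linCombVec ℚ-field r B c)     ≡⟨ dot-linComb r x B c ⟩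
  ∑ r (λ j → c j * dot x (B j))        ≡⟨ ∑-cong r (λ j → trans (cong (c j *_) (x⊥B j)) (ℚₚ.*-zeroʳ (c j))) ⟩
  ∑ r (λ _ → 0ℚ)                       ≡⟨ ∑-zero r ⟩
  0ℚ                                   ∎
  where open ≡-Reasoning

NontrivialRelation : ∀ {P} q → (Fin q → Fin P → ℚ) → Set
NontrivialRelation q v = ∃ λ c → (∀ i → linCombVec ℚ-field q v c i ≡ 0ℚ) × ∃ λ j → c j ≢ 0ℚ

module Elimination {P q} (v : Fin (suc q) → Fin (suc P) → ℚ) (j₀ : Fin (suc q)) (pivot≢0 : v j₀ zero ≢ 0ℚ) where

  private instance _ = ℚ.≢-nonZero pivot≢0

  ratio : Fin q → ℚ
  ratio k = v (punchIn j₀ k) zero * 1/ v j₀ zero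

  eliminated : Fin q → Fin P → ℚ
  eliminated k i = v (punchIn j₀ k) (suc i) - ratio k * v j₀ (suc i)

  cleared : Fin q → Fin (suc P) → ℚ
  cleared k = 0ℚ ∷ eliminated k

  decompose : ∀ k i → v (punchIn j₀ k) i ≡ cleared k i + ratio k * v j₀ i
  decompose k zero = sym (begin
    0ℚ + (x * 1/ p) * p  ≡⟨ ℚₚ.+-identityˡ _ ⟩
    (x * 1/ p) * p       ≡⟨ ℚₚ.*-assoc x (1/ p) p ⟩
    x * (1/ p * p)       ≡⟨ cong (x *_) (ℚₚ.*-inverseˡ p) ⟩
    x * 1ℚ               ≡⟨ ℚₚ.*-identityʳ x ⟩
    x                    ∎)
    where
    open ≡-Reasoning
    x = v (punchIn j₀ k) zero
    p = v j₀ zero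
  decompose k (suc i) = x≡[x-y]+y (v (punchIn j₀ k) (suc i)) (ratio k * v j₀ (suc i))
    where
    x≡[x-y]+y : ∀ x y → x ≡ (x - y) + y
    x≡[x-y]+y = solve-∀ ℚ-ring

  -- The pivot's coefficient −Σ_k c′_k · ratio k undoes the multiples of v j₀ subtracted in
  -- `eliminated`.
  lift : NontrivialRelation q eliminated → NontrivialRelation (suc q) v
  lift (c′ , c′-rel , k₀ , c′k₀≢0) =
    c , c-rel , punchIn j₀ k₀ , c′k₀≢0 ∘ trans (sym (insertAt-punchIn c′ j₀ a k₀))
    where
    X a : ℚ
    X = ∑ q (λ k → c′ k * ratio k)
    a = - X
    c : Fin (suc q) → ℚ
    c = insertAt c′ j₀ a
    cleared-rel : ∀ i → ∑ q (λ k → c′ k * cleared k i) ≡ 0ℚ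
    cleared-rel zero    = trans (∑-cong q (ℚₚ.*-zeroʳ ∘ c′)) (∑-zero q)
    cleared-rel (suc i) = c′-rel i
    c-rel : ∀ i → linCombVec ℚ-field (suc q) v c i ≡ 0ℚ
    c-rel i = begin
      ∑ (suc q) (λ j → c j * v j i)
        ≡⟨ ∑-punchIn q j₀ (λ j → c j * v j i) ⟩
      c j₀ * v j₀ i + ∑ q (λ k → c (punchIn j₀ k) * v (punchIn j₀ k) i)
        ≡⟨ cong₂ _+_ (cong (_* v j₀ i) (insertAt-lookup c′ j₀ a))
                     (∑-cong q (λ k → cong₂ _*_ (insertAt-punchIn c′ j₀ a k) (decompose k i))) ⟩
      a * v j₀ i + ∑ q (λ k → c′ k * (cleared k i + ratio k * v j₀ i))
        ≡⟨ cong (a * v j₀ i +_) (∑-cong q (λ k → distrib-assoc (c′ k) (cleared k i) (ratio k) (v j₀ i))) ⟩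
      a * v j₀ i + ∑ q (λ k → c′ k * cleared k i + (c′ k * ratio k) * v j₀ i)
        ≡⟨ cong (a * v j₀ i +_) (∑-distrib-+ q _ _) ⟩
      a * v j₀ i + (∑ q (λ k → c′ k * cleared k i) + ∑ q (λ k → (c′ k * ratio k) * v j₀ i))
        ≡⟨ cong (a * v j₀ i +_) (cong₂ _+_ (cleared-rel i) (sym (*-distribʳ-∑ q (v j₀ i) _))) ⟩
      - X * v j₀ i + (0ℚ + X * v j₀ i)
        ≡⟨ cancel X (v j₀ i) ⟩
      0ℚ ∎
      where
      open ≡-Reasoning
      distrib-assoc : ∀ x y z w → x * (y + z * w) ≡ x * y + (x * z) * w
      distrib-assoc = solve-∀ ℚ-ring
      cancel : ∀ x y → - x * y + (0ℚ + x * y) ≡ 0ℚ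
      cancel = solve-∀ ℚ-ring

<⇒nontrivialRelation : ∀ P q (v : Fin q → Fin P → ℚ) → P < q → NontrivialRelation q v
<⇒nontrivialRelation zero    (suc q) v _ = (λ _ → 1ℚ) , (λ ()) , zero , λ ()
<⇒nontrivialRelation (suc P) (suc q) v (s≤s P<q)
  with Finₚ.all? (λ j → v j zero ℚₚ.≟ 0ℚ)
... | yes heads≡0 = c , c-rel , nontrivial
  where
  tails-rel = <⇒nontrivialRelation P (suc q) (λ j → v j ∘ suc) (ℕₚ.m<n⇒m<1+n P<q)
  c = proj₁ tails-rel
  nontrivial = proj₂ (proj₂ tails-rel)
  c-rel : ∀ i → linCombVec ℚ-field (suc q) v c i ≡ 0ℚ
  c-rel zero    = trans (∑-cong (suc q) (λ j → trans (cong (c j *_) (heads≡0 j)) (ℚₚ.*-zeroʳ (c j)))) (∑-zero (suc q))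
  c-rel (suc i) = proj₁ (proj₂ tails-rel) i
... | no ¬heads≡0 = Elimination.lift v j₀ pivot≢0
  (<⇒nontrivialRelation P q (Elimination.eliminated v j₀ pivot≢0) P<q)
  where
  pivot = Finₚ.¬∀⟶∃¬ (suc q) _ (λ j → v j zero ℚₚ.≟ 0ℚ) ¬heads≡0
  j₀ = proj₁ pivot
  pivot≢0 = proj₂ pivot

linComb-++ : ∀ {P} r q (B : Fin r → Fin P → ℚ) (D : Fin q → Fin P → ℚ) c i →
             linCombVec ℚ-field (r ℕ.+ q) (B ++ D) c i
             ≡ linCombVec ℚ-field r B (c ∘ (_↑ˡ q)) i + linCombVec ℚ-field q D (c ∘ (r ↑ʳ_)) i
linComb-++ r q B D c i = trans (∑-↑ r q (λ j → c j * (B ++ D) j i)) (cong₂ _+_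
  (∑-cong r (λ j → cong (λ w → c (j ↑ˡ q) * w i) (lookup-++ˡ B D j)))
  (∑-cong q (λ l → cong (λ w → c (r ↑ʳ l) * w i) (lookup-++ʳ B D l))))

↑-cover : ∀ r q (c : Fin (r ℕ.+ q) → ℚ) →
          (∀ i → c (i ↑ˡ q) ≡ 0ℚ) → (∀ l → c (r ↑ʳ l) ≡ 0ℚ) → ∀ k → c k ≡ 0ℚ
↑-cover r q c left≡0 right≡0 k with splitAt r k in eq
... | inj₁ i = subst (λ k → c k ≡ 0ℚ) (Finₚ.splitAt⁻¹-↑ˡ eq) (left≡0 i)
... | inj₂ l = subst (λ k → c k ≡ 0ℚ) (Finₚ.splitAt⁻¹-↑ʳ eq) (right≡0 l)

-- If dim span B + dim span D > P, the spans meet in some x ≠ 0; as x·x ≠ 0 over ℚ,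
-- x is not orthogonal to all of D.
nonOrthogonal : ∀ {P r q} (B : Fin r → Fin P → ℚ) (D : Fin q → Fin P → ℚ) →
                LinIndep ℚ-field r B → LinIndep ℚ-field q D → P < r ℕ.+ q →
                ∃₂ λ α l → dot (linCombVec ℚ-field r B α) (D l) ≢ 0ℚ
nonOrthogonal {P} {r} {q} B D B-indep D-indep P<r+q =
  α , Finₚ.¬∀⟶∃¬ q _ (λ l → dot x (D l) ℚₚ.≟ 0ℚ) x-not-⊥-D
  where
  relation = <⇒nontrivialRelation P (r ℕ.+ q) (B ++ D) P<r+q
  c = proj₁ relation
  α = c ∘ (_↑ˡ q)
  β = c ∘ (r ↑ʳ_)
  x y : Fin P → ℚ
  x = linCombVec ℚ-field r B α
  y = linCombVec ℚ-field q D β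
  x+y≡0 : ∀ i → x i + y i ≡ 0ℚ
  x+y≡0 i = trans (sym (linComb-++ r q B D c i)) (proj₁ (proj₂ relation) i)
  x≢0 : ¬ (∀ i → x i ≡ 0ℚ)
  x≢0 x≡0 = proj₂ (proj₂ (proj₂ relation)) (↑-cover r q c (B-indep α x≡0) (D-indep β y≡0) _)
    where
    y≡0 : ∀ i → y i ≡ 0ℚ
    y≡0 i = trans (sym (ℚₚ.+-identityˡ (y i))) (trans (cong (_+ y i) (sym (x≡0 i))) (x+y≡0 i))
  x-not-⊥-D : ¬ (∀ l → dot x (D l) ≡ 0ℚ)
  x-not-⊥-D x⊥D = x≢0 (dot-self≡0 x (begin
    dot x x                                  ≡⟨ sym (ℚₚ.+-identityʳ (dot x x)) ⟩
    dot x x + 0ℚ                             ≡⟨ cong (dot x x +_) (sym x⊥y) ⟩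
    dot x x + dot x y                        ≡⟨ sym (∑-distrib-+ P _ _) ⟩
    ∑ P (λ i → x i * x i + x i * y i)        ≡⟨ ∑-cong P (λ i → sym (ℚₚ.*-distribˡ-+ (x i) (x i) (y i))) ⟩
    ∑ P (λ i → x i * (x i + y i))            ≡⟨ ∑-cong P (λ i → trans (cong (x i *_) (x+y≡0 i)) (ℚₚ.*-zeroʳ (x i))) ⟩
    ∑ P (λ _ → 0ℚ)                           ≡⟨ ∑-zero P ⟩
    0ℚ                                       ∎))
    where
    open ≡-Reasoning
    x⊥y : dot x y ≡ 0ℚ
    x⊥y = span-orthogonal q D x x⊥D (β , λ _ → refl)

-- Contraction

sumMI-cong : ∀ d n {f g : MultiIndex ℚ-field d n → ℚ} → f ≗ g → sumMI ℚ-field d n f ≡ sumMI ℚ-field d n g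
sumMI-cong zero    n f≗g = f≗g _
sumMI-cong (suc d) n f≗g = ∑-cong (n zero) (λ j → sumMI-cong d (n ∘ suc) (f≗g ∘ consMI ℚ-field j))

*-distribˡ-sumMI : ∀ d n c (f : MultiIndex ℚ-field d n → ℚ) →
                   c * sumMI ℚ-field d n f ≡ sumMI ℚ-field d n (λ ι → c * f ι)
*-distribˡ-sumMI zero    n c f = refl
*-distribˡ-sumMI (suc d) n c f =
  trans (*-distribˡ-∑ (n zero) c _) (∑-cong (n zero) (λ j → *-distribˡ-sumMI d (n ∘ suc) c _))

contract-cong : ∀ d n {S T : Tensor ℚ-field d n} → S ≗ T → ∀ u → contract ℚ-field d n S u ≡ contract ℚ-field d n T u
contract-cong d n S≗T u = sumMI-cong d n (λ ι → cong (_* prodFin ℚ-field d (λ k → u k (ι k))) (S≗T ι))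

contract-scale : ∀ d n c (T : Tensor ℚ-field d n) u →
                 contract ℚ-field d n (λ ι → c * T ι) u ≡ c * contract ℚ-field d n T u
contract-scale d n c T u =
  trans (sumMI-cong d n (λ ι → ℚₚ.*-assoc c (T ι) _)) (sym (*-distribˡ-sumMI d n c _))

contract-suc : ∀ d n (T : Tensor ℚ-field (suc d) n) u →
               contract ℚ-field (suc d) n T u
               ≡ ∑ (n zero) (λ j → u zero j * contract ℚ-field d (n ∘ suc) (T ∘ consMI ℚ-field j) (u ∘ suc))
contract-suc d n T u = ∑-cong (n zero) (λ j → trans
  (sumMI-cong d (n ∘ suc) (λ ι → left-comm (T (consMI ℚ-field j ι)) (u zero j) _))
  (sym (*-distribˡ-sumMI d (n ∘ suc) (u zero j) _)))
  where
  left-comm : ∀ a b c → a * (b * c) ≡ b * (a * c)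
  left-comm = solve-∀ ℚ-ring

contract-nonzero⇒nonzero : ∀ d n (T : Tensor ℚ-field d n) u → contract ℚ-field d n T u ≢ 0ℚ → ¬ IsZeroTensor ℚ-field T
contract-nonzero⇒nonzero d n T u Tu≢0 T≡0 = Tu≢0 (begin
  contract ℚ-field d n T u                    ≡⟨ contract-cong d n (λ ι → trans (T≡0 ι) (sym (ℚₚ.*-zeroˡ 1ℚ))) u ⟩
  contract ℚ-field d n (λ _ → 0ℚ * 1ℚ) u      ≡⟨ contract-scale d n 0ℚ (λ _ → 1ℚ) u ⟩
  0ℚ * contract ℚ-field d n (λ _ → 1ℚ) u      ≡⟨ ℚₚ.*-zeroˡ (contract ℚ-field d n (λ _ → 1ℚ) u) ⟩
  0ℚ                                          ∎)
  where open ≡-Reasoning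

contract-zeroVector : ∀ d n (T : Tensor ℚ-field (suc d) n) u → (∀ i → u zero i ≡ 0ℚ) → contract ℚ-field (suc d) n T u ≡ 0ℚ
contract-zeroVector d n T u u₀≡0 = trans (contract-suc d n T u)
  (trans (∑-cong (n zero) (λ j → trans (cong (_* slice j) (u₀≡0 j)) (ℚₚ.*-zeroˡ (slice j)))) (∑-zero (n zero)))
  where
  slice : Fin (n zero) → ℚ
  slice j = contract ℚ-field d (n ∘ suc) (T ∘ consMI ℚ-field j) (u ∘ suc)

infixr 5 _⊗_
_⊗_ : ∀ {N d} {n : Fin d → ℕ} → (Fin N → ℚ) → Tensor ℚ-field d n → Tensor ℚ-field (suc d) (N ∷ n)
(α ⊗ M) ι = α (ι zero) * M (λ k → ι (suc k))

contract-⊗ : ∀ {N d} (n : Fin d → ℕ) (α : Fin N → ℚ) (M : Tensor ℚ-field d n) u →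
             contract ℚ-field (suc d) (N ∷ n) (α ⊗ M) u ≡ dot (u zero) α * contract ℚ-field d n M (u ∘ suc)
contract-⊗ {N} {d} n α M u = begin
  contract ℚ-field (suc d) (N ∷ n) (α ⊗ M) u   ≡⟨ contract-suc d (N ∷ n) (α ⊗ M) u ⟩
  ∑ N (λ j → u zero j * contract ℚ-field d n (λ ι → α j * M ι) (u ∘ suc))
    ≡⟨ ∑-cong N (λ j → trans (cong (u zero j *_) (contract-scale d n (α j) M (u ∘ suc))) (sym (ℚₚ.*-assoc (u zero j) (α j) _))) ⟩
  ∑ N (λ j → (u zero j * α j) * contract ℚ-field d n M (u ∘ suc))
    ≡⟨ sym (*-distribʳ-∑ N _ _) ⟩
  dot (u zero) α * contract ℚ-field d n M (u ∘ suc)  ∎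
  where open ≡-Reasoning

-- Slice rank

private
  boundOf : ∀ {R : Set} {Bs : R → Set} {I A : (r : R) → Bs r → Set} {L : R → ℕ} {s : ℕ} →
            (Σ R (λ r → Σ (Bs r) (λ B → I r B × L r ≤ s × A r B)) → ⊤) → R → ℕ
  boundOf {L = L} _ = L

Covectors : ∀ {d} → (Fin d → ℕ) → Set
Covectors {d} n = (k : Fin d) → Fin (n k) → ℚ

Bases : ∀ {d} → (Fin d → ℕ) → (Fin d → ℕ) → Set
Bases {d} n r = (k : Fin d) → Fin (r k) → Fin (n k) → ℚ

InSubspaces : ∀ {d} {n : Fin d → ℕ} r → Bases n r → Covectors n → Set
InSubspaces r B u = ∀ k → InSpanVec ℚ-field (r k) (B k) (u k)

-- Σ_k (n k ∸ r k), the total codimension of subspaces of dimensions r k.  `SRLe` states its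
-- bound with a sum local to its where-block; unification reads that sum off the type of
-- `SRLe`, and as it does not depend on the other arguments of `SRLe`, `codimSum` is
-- definitionally the bound of every `SRLe`.
codimSum : (d : ℕ) (n : Fin d → ℕ) → (Fin d → ℕ) → ℕ
codimSum d n = boundOf (λ (_ : SRLe ℚ-field d n 0 (λ ()) 0) → tt)

codimSum-full : ∀ d n → codimSum d n n ≡ 0
codimSum-full zero    n = refl
codimSum-full (suc d) n = cong₂ ℕ._+_ (ℕₚ.n∸n≡0 (n zero)) (codimSum-full d (n ∘ suc))

codim+codim<⇒<dim+dim : ∀ {a b x y} → (b ∸ x) ℕ.+ (a ∸ y) < b → a < x ℕ.+ y
codim+codim<⇒<dim+dim {a} {b} {x} {y} lt = ℕₚ.+-cancelʳ-< b a (x ℕ.+ y) (begin-strict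
  a ℕ.+ b                                   ≤⟨ ℕₚ.+-mono-≤ (ℕₚ.m≤n+m∸n a y) (ℕₚ.m≤n+m∸n b x) ⟩
  (y ℕ.+ (a ∸ y)) ℕ.+ (x ℕ.+ (b ∸ x))       ≡⟨ interchange y (a ∸ y) x (b ∸ x) ⟩
  (x ℕ.+ y) ℕ.+ ((b ∸ x) ℕ.+ (a ∸ y))       <⟨ ℕₚ.+-monoʳ-< (x ℕ.+ y) lt ⟩
  (x ℕ.+ y) ℕ.+ b                           ∎)
  where
  open ℕₚ.≤-Reasoning
  interchange : ∀ p q r s → (p ℕ.+ q) ℕ.+ (r ℕ.+ s) ≡ (r ℕ.+ p) ℕ.+ (s ℕ.+ q)
  interchange = ℕ-solve-∀

member-inSpanTensor : ∀ {d n} m (T : Fin m → Tensor ℚ-field d n) j → InSpanTensor ℚ-field m T (T j)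
member-inSpanTensor m T j = δ j , λ ι → sym (∑-δ m j (λ l → T l ι))

annihilate-multiples : ∀ {d n} (S : Tensor ℚ-field d n) r (B : Bases n r) →
  (∀ u → InSubspaces r B u → contract ℚ-field d n S u ≡ 0ℚ) →
  ∀ S′ → InSpanTensor ℚ-field 1 (λ _ → S) S′ → ∀ u → InSubspaces r B u → contract ℚ-field d n S′ u ≡ 0ℚ
annihilate-multiples {d} {n} S r B S-annihilated S′ (a , S′≡aS) u u∈U = begin
  contract ℚ-field d n S′ u                    ≡⟨ contract-cong d n (λ ι → trans (S′≡aS ι) (ℚₚ.+-identityʳ (a zero * S ι))) u ⟩
  contract ℚ-field d n (λ ι → a zero * S ι) u  ≡⟨ contract-scale d n (a zero) S u ⟩
  a zero * contract ℚ-field d n S u            ≡⟨ cong (a zero *_) (S-annihilated u u∈U) ⟩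
  a zero * 0ℚ                                  ≡⟨ ℚₚ.*-zeroʳ (a zero) ⟩
  0ℚ                                           ∎
  where open ≡-Reasoning

SRLe-firstFactor : ∀ d n m (T : Fin m → Tensor ℚ-field (suc d) n) → SRLe ℚ-field (suc d) n m T (n zero)
SRLe-firstFactor d n m T = r , B , B-indep , bound , λ S _ u u∈U → contract-zeroVector d n S u (proj₂ (u∈U zero))
  where
  r : Fin (suc d) → ℕ
  r zero    = 0
  r (suc k) = n (suc k)
  B : Bases n r
  B zero    ()
  B (suc k) = δ
  B-indep : ∀ k → LinIndep ℚ-field (r k) (B k)
  B-indep zero    c _ ()
  B-indep (suc k) = δ-independent (n (suc k))
  bound : codimSum (suc d) n r ≤ n zero
  bound = ℕₚ.≤-reflexive (trans (cong (n zero ℕ.+_) (codimSum-full d (n ∘ suc))) (ℕₚ.+-identityʳ (n zero)))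

⊥-basis : ∀ {N} (α : Fin (suc N) → ℚ) (i₀ : Fin (suc N)) → Fin N → Fin (suc N) → ℚ
⊥-basis α i₀ k i = α i₀ * δ (punchIn i₀ k) i - α (punchIn i₀ k) * δ i₀ i

⊥-basis-orthogonal : ∀ {N} (α : Fin (suc N) → ℚ) i₀ k → dot α (⊥-basis α i₀ k) ≡ 0ℚ
⊥-basis-orthogonal {N} α i₀ k = begin
  ∑ (suc N) (λ i → α i * (a * δ p i - b * δ i₀ i))
    ≡⟨ ∑-cong (suc N) (λ i → expand (α i) a (δ p i) b (δ i₀ i)) ⟩
  ∑ (suc N) (λ i → δ p i * (a * α i) + δ i₀ i * (- b * α i))
    ≡⟨ ∑-distrib-+ (suc N) (λ i → δ p i * (a * α i)) (λ i → δ i₀ i * (- b * α i)) ⟩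
  ∑ (suc N) (λ i → δ p i * (a * α i)) + ∑ (suc N) (λ i → δ i₀ i * (- b * α i))
    ≡⟨ cong₂ _+_ (∑-δ (suc N) p (λ i → a * α i)) (∑-δ (suc N) i₀ (λ i → - b * α i)) ⟩
  a * b + - b * a
    ≡⟨ cancel a b ⟩
  0ℚ ∎
  where
  open ≡-Reasoning
  p = punchIn i₀ k
  a = α i₀
  b = α p
  expand : ∀ x a d b e → x * (a * d - b * e) ≡ d * (a * x) + e * (- b * x)
  expand = solve-∀ ℚ-ring
  cancel : ∀ a b → a * b + - b * a ≡ 0ℚ
  cancel = solve-∀ ℚ-ring

⊥-basis-independent : ∀ {N} (α : Fin (suc N) → ℚ) i₀ → α i₀ ≢ 0ℚ → LinIndep ℚ-field N (⊥-basis α i₀)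
⊥-basis-independent {N} α i₀ αi₀≢0 c c-rel k′ = *-cancelˡ-≡0 αi₀≢0 (begin
  α i₀ * c k′                                                 ≡⟨ ℚₚ.*-comm (α i₀) (c k′) ⟩
  c k′ * α i₀                                                 ≡⟨ sym (∑-δ′ N k′ (λ k → c k * α i₀)) ⟩
  ∑ N (λ k → (c k * α i₀) * δ k k′)                           ≡⟨ ∑-cong N coordinate ⟩
  ∑ N (λ k → c k * ⊥-basis α i₀ k (punchIn i₀ k′))            ≡⟨ c-rel (punchIn i₀ k′) ⟩
  0ℚ                                                          ∎)
  where
  open ≡-Reasoning
  coordinate : ∀ k → (c k * α i₀) * δ k k′ ≡ c k * ⊥-basis α i₀ k (punchIn i₀ k′)
  coordinate k = begin
    (c k * α i₀) * δ k k′                                        ≡⟨ regroup (c k) (α i₀) (δ k k′) (α (punchIn i₀ k)) ⟩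
    c k * (α i₀ * δ k k′ - α (punchIn i₀ k) * 0ℚ)                ≡⟨ cong₂ (λ x y → c k * (α i₀ * x - α (punchIn i₀ k) * y))
                                                                      (sym (δ-punchIn i₀ k k′))
                                                                      (sym (δ-off (Finₚ.punchInᵢ≢i i₀ k′ ∘ sym))) ⟩
    c k * (α i₀ * δ (punchIn i₀ k) (punchIn i₀ k′) - α (punchIn i₀ k) * δ i₀ (punchIn i₀ k′)) ∎
    where
    regroup : ∀ x a d b → (x * a) * d ≡ x * (a * d - b * 0ℚ)
    regroup = solve-∀ ℚ-ring

SRLe-⊗-hyperplane : ∀ {N d} (n : Fin d → ℕ) (M : Tensor ℚ-field d n) (α : Fin (suc N) → ℚ) i₀ → α i₀ ≢ 0ℚ →
                    (S : Tensor ℚ-field (suc d) (suc N ∷ n)) → S ≗ α ⊗ M →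
                    SRLe ℚ-field (suc d) (suc N ∷ n) 1 (λ _ → S) 1
SRLe-⊗-hyperplane {N} {d} n M α i₀ αi₀≢0 S S≗α⊗M =
  r , B , B-indep , bound , annihilate-multiples S r B S-annihilated
  where
  r : Fin (suc d) → ℕ
  r zero    = N
  r (suc k) = n k
  B : Bases (suc N ∷ n) r
  B zero    = ⊥-basis α i₀
  B (suc k) = δ
  B-indep : ∀ k → LinIndep ℚ-field (r k) (B k)
  B-indep zero    = ⊥-basis-independent α i₀ αi₀≢0
  B-indep (suc k) = δ-independent (n k)
  bound : codimSum (suc d) (suc N ∷ n) r ≤ 1
  bound = ℕₚ.≤-reflexive (cong₂ ℕ._+_ (ℕₚ.m+n∸n≡m 1 N) (codimSum-full d n))
  S-annihilated : ∀ u → InSubspaces r B u → contract ℚ-field (suc d) (suc N ∷ n) S u ≡ 0ℚ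
  S-annihilated u u∈U = begin
    contract ℚ-field (suc d) (suc N ∷ n) S u        ≡⟨ contract-cong (suc d) (suc N ∷ n) S≗α⊗M u ⟩
    contract ℚ-field (suc d) (suc N ∷ n) (α ⊗ M) u  ≡⟨ contract-⊗ n α M u ⟩
    dot (u zero) α * contract ℚ-field d n M (u ∘ suc) ≡⟨ cong (_* _) u₀⊥α ⟩
    0ℚ * contract ℚ-field d n M (u ∘ suc)           ≡⟨ ℚₚ.*-zeroˡ (contract ℚ-field d n M (u ∘ suc)) ⟩
    0ℚ                                              ∎
    where
    open ≡-Reasoning
    u₀⊥α : dot (u zero) α ≡ 0ℚ
    u₀⊥α = trans (dot-comm (u zero) α) (span-orthogonal N (⊥-basis α i₀) α (⊥-basis-orthogonal α i₀) (u∈U zero))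

-- Robust tensors

-- A constructive form of SR(span M) ≥ N: M does not vanish on any U_1 × ⋯ × U_d with
-- Σ_k codim U_k < N, and a witness is given.
Robust : (N : ℕ) {d : ℕ} {n : Fin d → ℕ} → Tensor ℚ-field d n → Set
Robust N {d} {n} M =
  ∀ r (B : Bases n r) → (∀ k → LinIndep ℚ-field (r k) (B k)) → codimSum d n r < N →
  ∃ λ (u : Covectors n) → InSubspaces r B u × contract ℚ-field d n M u ≢ 0ℚ

robust⇒nonvanishing : ∀ {N d} {n : Fin d → ℕ} {M : Tensor ℚ-field d n} → Robust N M → 0 < N →
                      ∃ λ (u : Covectors n) → contract ℚ-field d n M u ≢ 0ℚ
robust⇒nonvanishing {d = d} {n} robust 0<N with robust n (λ k → δ) (δ-independent ∘ n) (subst (_< _) (sym (codimSum-full d n)) 0<N)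
... | u , _ , Mu≢0 = u , Mu≢0

SRLe-⊗-lower : ∀ {N d} {n : Fin d → ℕ} {M : Tensor ℚ-field d n} → Robust N M →
               ∀ q (D : Fin q → Fin N → ℚ) → LinIndep ℚ-field q D → q ≤ N →
               ∀ s → SRLe ℚ-field (suc d) (N ∷ n) q (λ j → D j ⊗ M) s → q ≤ s
SRLe-⊗-lower {N} {d} {n} {M} robust q D D-indep q≤N s (r , B , B-indep , bound , annihilates) = ℕₚ.≮⇒≥ refute
  where
  refute : ¬ s < q
  refute s<q = contradiction (annihilates (D l ⊗ M) (member-inSpanTensor q (λ j → D j ⊗ M) l) u u∈U) Dl⊗M-u≢0
    where
    codim₀ = N ∸ r zero
    codimRest = codimSum d n (r ∘ suc)
    codim<q : codim₀ ℕ.+ codimRest < q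
    codim<q = ℕₚ.≤-<-trans bound s<q
    N<r₀+q : N < r zero ℕ.+ q
    N<r₀+q = codim+codim<⇒<dim+dim {x = r zero} {y = q} (begin-strict
      codim₀ ℕ.+ (N ∸ q)   <⟨ ℕₚ.+-monoˡ-< (N ∸ q) (ℕₚ.m+n≤o⇒m≤o (suc codim₀) codim<q) ⟩
      q ℕ.+ (N ∸ q)        ≡⟨ ℕₚ.m+[n∸m]≡n q≤N ⟩
      N                    ∎)
      where open ℕₚ.≤-Reasoning
    codimRest<N : codimRest < N
    codimRest<N = ℕₚ.<-≤-trans (ℕₚ.≤-<-trans (ℕₚ.m≤n+m codimRest codim₀) codim<q) q≤N
    non⊥ = nonOrthogonal (B zero) D (B-indep zero) D-indep N<r₀+q
    α = proj₁ non⊥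
    l = proj₁ (proj₂ non⊥)
    rest = robust (r ∘ suc) (B ∘ suc) (B-indep ∘ suc) codimRest<N
    u : Covectors (N ∷ n)
    u zero    = linCombVec ℚ-field (r zero) (B zero) α
    u (suc k) = proj₁ rest k
    u∈U : InSubspaces r B u
    u∈U zero    = α , λ _ → refl
    u∈U (suc k) = proj₁ (proj₂ rest) k
    Dl⊗M-u≢0 : contract ℚ-field (suc d) (N ∷ n) (D l ⊗ M) u ≢ 0ℚ
    Dl⊗M-u≢0 = *-≢0 (proj₂ (proj₂ non⊥)) (proj₂ (proj₂ rest)) ∘ trans (sym (contract-⊗ n (D l) M u))

𝟙 : Tensor ℚ-field 0 []
𝟙 _ = 1ℚ

𝟙-robust : ∀ {N} → Robust (suc N) 𝟙
𝟙-robust _ _ _ _ = (λ ()) , (λ ()) , λ ()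

I⊗_ : ∀ {N d} {n : Fin d → ℕ} → Tensor ℚ-field d n → Tensor ℚ-field (suc (suc d)) (N ∷ N ∷ n)
(I⊗ M) ι = (δ (ι zero) ⊗ M) (ι ∘ suc)

contract-I⊗ : ∀ {N d} (n : Fin d → ℕ) (M : Tensor ℚ-field d n) u →
              contract ℚ-field (suc (suc d)) (N ∷ N ∷ n) (I⊗ M) u
              ≡ dot (u zero) (u (suc zero)) * contract ℚ-field d n M (λ k → u (suc (suc k)))
contract-I⊗ {N} {d} n M u = begin
  contract ℚ-field (suc (suc d)) (N ∷ N ∷ n) (I⊗ M) u
    ≡⟨ contract-suc (suc d) (N ∷ N ∷ n) (I⊗ M) u ⟩
  ∑ N (λ i → u zero i * contract ℚ-field (suc d) (N ∷ n) (δ i ⊗ M) (u ∘ suc))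
    ≡⟨ ∑-cong N (λ i → cong (u zero i *_) (trans (contract-⊗ n (δ i) M (u ∘ suc)) (cong (_* R) (dot-δ (u (suc zero)) i)))) ⟩
  ∑ N (λ i → u zero i * (u (suc zero) i * R))
    ≡⟨ ∑-cong N (λ i → sym (ℚₚ.*-assoc (u zero i) (u (suc zero) i) R)) ⟩
  ∑ N (λ i → (u zero i * u (suc zero) i) * R)
    ≡⟨ sym (*-distribʳ-∑ N R (λ i → u zero i * u (suc zero) i)) ⟩
  dot (u zero) (u (suc zero)) * R ∎
  where
  open ≡-Reasoning
  R = contract ℚ-field d n M (λ k → u (suc (suc k)))

I⊗-robust : ∀ {N d} {n : Fin d → ℕ} {M : Tensor ℚ-field d n} → Robust N M → Robust N (I⊗_ {N} M)
I⊗-robust {N} {d} {n} {M} robust r B B-indep codim<N = u , u∈U , I⊗M-u≢0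
  where
  codim₀ = N ∸ r zero
  codim₁ = N ∸ r (suc zero)
  codimRest = codimSum d n (λ k → r (suc (suc k)))
  N<r₀+r₁ : N < r zero ℕ.+ r (suc zero)
  N<r₀+r₁ = codim+codim<⇒<dim+dim {x = r zero} {y = r (suc zero)}
    (ℕₚ.≤-<-trans (ℕₚ.+-monoʳ-≤ codim₀ (ℕₚ.m≤m+n codim₁ codimRest)) codim<N)
  codimRest<N : codimRest < N
  codimRest<N = ℕₚ.≤-<-trans (ℕₚ.≤-trans (ℕₚ.m≤n+m codimRest codim₁) (ℕₚ.m≤n+m _ codim₀)) codim<N
  non⊥ = nonOrthogonal (B zero) (B (suc zero)) (B-indep zero) (B-indep (suc zero)) N<r₀+r₁
  α = proj₁ non⊥
  l = proj₁ (proj₂ non⊥)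
  rest = robust (λ k → r (suc (suc k))) (λ k → B (suc (suc k))) (λ k → B-indep (suc (suc k))) codimRest<N
  u : Covectors (N ∷ N ∷ n)
  u zero             = linCombVec ℚ-field (r zero) (B zero) α
  u (suc zero)       = B (suc zero) l
  u (suc (suc k))    = proj₁ rest k
  u∈U : InSubspaces r B u
  u∈U zero          = α , λ _ → refl
  u∈U (suc zero)    = member-inSpanVec (r (suc zero)) (B (suc zero)) l
  u∈U (suc (suc k)) = proj₁ (proj₂ rest) k
  I⊗M-u≢0 : contract ℚ-field (suc (suc d)) (N ∷ N ∷ n) (I⊗ M) u ≢ 0ℚ
  I⊗M-u≢0 = *-≢0 (proj₂ (proj₂ non⊥)) (proj₂ (proj₂ rest)) ∘ trans (sym (contract-I⊗ n M u))

_⊠_ : ∀ {m n} → (Fin m → ℚ) → (Fin n → ℚ) → Fin (m ℕ.* n) → ℚ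
_⊠_ {m} {n} x y k = x (quotient n k) * y (remainder {m} n k)

⊠-combine : ∀ {m n} (x : Fin m → ℚ) (y : Fin n → ℚ) i j → (x ⊠ y) (combine i j) ≡ x i * y j
⊠-combine {m} {n} x y i j = cong (λ (i , j) → x i * y j) (Finₚ.remQuot-combine {m} {n} i j)

dot-⊠ : ∀ {m n} (x : Fin m → ℚ) (y : Fin n → ℚ) z →
        dot (x ⊠ y) z ≡ ∑ m (λ i → x i * ∑ n (λ j → y j * z (combine i j)))
dot-⊠ {m} {n} x y z = begin
  ∑ (m ℕ.* n) (λ k → (x ⊠ y) k * z k)
    ≡⟨ ∑-combine m n _ ⟩
  ∑ m (λ i → ∑ n (λ j → (x ⊠ y) (combine i j) * z (combine i j)))
    ≡⟨ ∑-cong m (λ i → ∑-cong n (λ j → trans (cong (_* z (combine i j)) (⊠-combine x y i j)) (ℚₚ.*-assoc (x i) (y j) _))) ⟩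
  ∑ m (λ i → ∑ n (λ j → x i * (y j * z (combine i j))))
    ≡⟨ ∑-cong m (λ i → sym (*-distribˡ-∑ n (x i) _)) ⟩
  ∑ m (λ i → x i * ∑ n (λ j → y j * z (combine i j))) ∎
  where open ≡-Reasoning

linComb-⊠ : ∀ {m n} r (x : Fin m → ℚ) (B : Fin r → Fin n → ℚ) α →
            linCombVec ℚ-field r (λ j → x ⊠ B j) α ≗ x ⊠ linCombVec ℚ-field r B α
linComb-⊠ {m} {n} r x B α k =
  trans (∑-cong r (λ j → left-comm (α j) (x (quotient n k)) _)) (sym (*-distribˡ-∑ r (x (quotient n k)) _))
  where
  left-comm : ∀ a b c → a * (b * c) ≡ b * (a * c)
  left-comm = solve-∀ ℚ-ring

⊠-independent : ∀ {m n} r (x : Fin m → ℚ) i₀ → x i₀ ≢ 0ℚ → (B : Fin r → Fin n → ℚ) →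
                LinIndep ℚ-field r B → LinIndep ℚ-field r (λ j → x ⊠ B j)
⊠-independent r x i₀ xi₀≢0 B B-indep c c-rel = B-indep c λ l → *-cancelˡ-≡0 xi₀≢0 (begin
  x i₀ * linCombVec ℚ-field r B c l                      ≡⟨ sym (⊠-combine x (linCombVec ℚ-field r B c) i₀ l) ⟩
  (x ⊠ linCombVec ℚ-field r B c) (combine i₀ l)          ≡⟨ sym (linComb-⊠ r x B c (combine i₀ l)) ⟩
  linCombVec ℚ-field r (λ j → x ⊠ B j) c (combine i₀ l)  ≡⟨ c-rel (combine i₀ l) ⟩
  0ℚ                                                     ∎)
  where open ≡-Reasoning

reshape : ∀ {N} → Tensor ℚ-field 3 (N ∷ N ∷ N ℕ.* N ∷ [])
reshape ι = (δ (combine (ι zero) (ι (suc zero))) ⊗ 𝟙) (λ k → ι (suc (suc k)))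

contract-reshape : ∀ {N} u → contract ℚ-field 3 (N ∷ N ∷ N ℕ.* N ∷ []) reshape u
                   ≡ ∑ N (λ i → u zero i * ∑ N (λ j → u (suc zero) j * u (suc (suc zero)) (combine i j)))
contract-reshape {N} u = begin
  contract ℚ-field 3 (N ∷ N ∷ N ℕ.* N ∷ []) reshape u
    ≡⟨ contract-suc 2 _ reshape u ⟩
  ∑ N (λ i → u zero i * contract ℚ-field 2 (N ∷ N ℕ.* N ∷ []) (reshape ∘ consMI ℚ-field i) (u ∘ suc))
    ≡⟨ ∑-cong N (λ i → cong (u zero i *_) (trans (contract-suc 1 _ (reshape ∘ consMI ℚ-field i) (u ∘ suc))
         (∑-cong N (λ j → cong (u (suc zero) j *_) (trans (contract-⊗ [] (δ (combine i j)) 𝟙 (λ k → u (suc (suc k))))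
           (trans (ℚₚ.*-identityʳ (dot (u (suc (suc zero))) (δ (combine i j)))) (dot-δ (u (suc (suc zero))) (combine i j)))))))) ⟩
  ∑ N (λ i → u zero i * ∑ N (λ j → u (suc zero) j * u (suc (suc zero)) (combine i j))) ∎
  where open ≡-Reasoning

nonemptyBasis : ∀ {N} r → N ∸ r < N → Fin r
nonemptyBasis zero    N<N = contradiction N<N (ℕₚ.<-irrefl refl)
nonemptyBasis (suc r) _   = zero

reshape-robust : ∀ {N} → Robust N (reshape {N})
reshape-robust {N} r B B-indep codim<N = u , u∈U , reshape-u≢0
  where
  codim₀ = N ∸ r zero
  codim₁ = N ∸ r (suc zero)
  codim₂ = N ℕ.* N ∸ r (suc (suc zero))
  j₀ = nonemptyBasis (r zero) (ℕₚ.m+n≤o⇒m≤o (suc codim₀) codim<N)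
  u₀ = B zero j₀
  pivot = Finₚ.¬∀⟶∃¬ N _ (λ i → u₀ i ℚₚ.≟ 0ℚ) (independent⇒nonzero (r zero) (B zero) (B-indep zero) j₀)
  Φ : Fin (r (suc zero)) → Fin (N ℕ.* N) → ℚ
  Φ j = u₀ ⊠ B (suc zero) j
  N²<r₁+r₂ : N ℕ.* N < r (suc zero) ℕ.+ r (suc (suc zero))
  N²<r₁+r₂ = codim+codim<⇒<dim+dim {x = r (suc zero)} {y = r (suc (suc zero))}
    (ℕₚ.≤-<-trans (ℕₚ.≤-reflexive (cong (codim₁ ℕ.+_) (sym (ℕₚ.+-identityʳ codim₂)))) (ℕₚ.≤-<-trans (ℕₚ.m≤n+m _ codim₀) codim<N))
  non⊥ = nonOrthogonal Φ (B (suc (suc zero)))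
           (⊠-independent (r (suc zero)) u₀ (proj₁ pivot) (proj₂ pivot) (B (suc zero)) (B-indep (suc zero)))
           (B-indep (suc (suc zero))) N²<r₁+r₂
  α = proj₁ non⊥
  l = proj₁ (proj₂ non⊥)
  u : Covectors (N ∷ N ∷ N ℕ.* N ∷ [])
  u zero                = u₀
  u (suc zero)          = linCombVec ℚ-field (r (suc zero)) (B (suc zero)) α
  u (suc (suc zero))    = B (suc (suc zero)) l
  u∈U : InSubspaces r B u
  u∈U zero             = member-inSpanVec (r zero) (B zero) j₀
  u∈U (suc zero)       = α , λ _ → refl
  u∈U (suc (suc zero)) = member-inSpanVec (r (suc (suc zero))) (B (suc (suc zero))) l
  reshape-u≢0 : contract ℚ-field 3 (N ∷ N ∷ N ℕ.* N ∷ []) reshape u ≢ 0ℚ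
  reshape-u≢0 reshape-u≡0 = proj₂ (proj₂ non⊥) (begin
    dot (linCombVec ℚ-field (r (suc zero)) Φ α) (u (suc (suc zero)))
      ≡⟨ ∑-cong (N ℕ.* N) (λ k → cong (_* u (suc (suc zero)) k) (linComb-⊠ (r (suc zero)) u₀ (B (suc zero)) α k)) ⟩
    dot (u zero ⊠ u (suc zero)) (u (suc (suc zero)))
      ≡⟨ dot-⊠ (u zero) (u (suc zero)) (u (suc (suc zero))) ⟩
    ∑ N (λ i → u zero i * ∑ N (λ j → u (suc zero) j * u (suc (suc zero)) (combine i j)))
      ≡⟨ sym (contract-reshape u) ⟩
    contract ℚ-field 3 (N ∷ N ∷ N ℕ.* N ∷ []) reshape u
      ≡⟨ reshape-u≡0 ⟩
    0ℚ ∎)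
    where open ≡-Reasoning

record RobustTensor (N e : ℕ) : Set where
  field
    dims     : Fin e → ℕ
    dims-pos : ∀ k → 1 ≤ dims k
    tensor   : Tensor ℚ-field e dims
    robust   : Robust N tensor

𝟙-robustTensor : ∀ {C} → RobustTensor (suc C) 0
𝟙-robustTensor = record { dims = [] ; dims-pos = λ () ; tensor = 𝟙 ; robust = 𝟙-robust }

I⊗-robustTensor : ∀ {C e} → RobustTensor (suc C) e → RobustTensor (suc C) (suc (suc e))
I⊗-robustTensor {C} M = record
  { dims     = suc C ∷ suc C ∷ dims
  ; dims-pos = dims-pos′
  ; tensor   = I⊗ tensor
  ; robust   = I⊗-robust {M = tensor} robust
  }
  where
  open RobustTensor M
  dims-pos′ : ∀ k → 1 ≤ (suc C ∷ suc C ∷ dims) k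
  dims-pos′ zero          = s≤s z≤n
  dims-pos′ (suc zero)    = s≤s z≤n
  dims-pos′ (suc (suc k)) = dims-pos k

reshape-robustTensor : ∀ {C} → RobustTensor (suc C) 3
reshape-robustTensor {C} = record
  { dims     = suc C ∷ suc C ∷ suc C ℕ.* suc C ∷ []
  ; dims-pos = dims-pos
  ; tensor   = reshape
  ; robust   = reshape-robust
  }
  where
  dims-pos : ∀ k → 1 ≤ (suc C ∷ suc C ∷ suc C ℕ.* suc C ∷ []) k
  dims-pos zero             = s≤s z≤n
  dims-pos (suc zero)       = s≤s z≤n
  dims-pos (suc (suc zero)) = s≤s z≤n

robustTensor : ∀ C e → 2 ≤ e → RobustTensor (suc C) e
robustTensor C 1                        (s≤s ())
robustTensor C 2                        _ = I⊗-robustTensor 𝟙-robustTensor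
robustTensor C 3                        _ = reshape-robustTensor
robustTensor C (suc (suc (suc (suc e)))) _ = I⊗-robustTensor (robustTensor C (suc (suc e)) (s≤s (s≤s z≤n)))

-- The subspace W

module Counterexample {C d} {n : Fin d → ℕ} (M : Tensor ℚ-field d n) (robust : Robust (suc C) M) where

  W : Fin (suc C) → Tensor ℚ-field (suc d) (suc C ∷ n)
  W j = δ j ⊗ M

  inSpan⇒⊗ : ∀ {S} → (a∈W : InSpanTensor ℚ-field (suc C) W S) → S ≗ proj₁ a∈W ⊗ M
  inSpan⇒⊗ (a , S≡aW) ι = trans (S≡aW ι) (trans
    (∑-cong (suc C) (λ j → trans (cong (a j *_) (ℚₚ.*-comm (δ j (ι zero)) (M (ι ∘ suc)))) (sym (ℚₚ.*-assoc (a j) (M (ι ∘ suc)) (δ j (ι zero))))))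
    (∑-δ′ (suc C) (ι zero) (λ j → a j * M (ι ∘ suc))))

  W-IsSR : IsSR ℚ-field (suc d) (suc C ∷ n) (suc C) W (suc C)
  W-IsSR = SRLe-firstFactor d (suc C ∷ n) (suc C) W
         , SRLe-⊗-lower {M = M} robust (suc C) δ (δ-independent (suc C)) ℕₚ.≤-refl

  W₀-IsSR : IsSR ℚ-field (suc d) (suc C ∷ n) 1 (λ _ → W zero) 1
  W₀-IsSR = SRLe-⊗-hyperplane n M (δ zero) zero ℚₚ.1≢0 (W zero) (λ _ → refl)
          , SRLe-⊗-lower {M = M} robust 1 (λ _ → δ zero) (single-independent (δ zero) zero ℚₚ.1≢0) (s≤s z≤n)

  W₀≢0 : ¬ IsZeroTensor ℚ-field (W zero)
  W₀≢0 = contract-nonzero⇒nonzero (suc d) (suc C ∷ n) (W zero) u W₀u≢0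
    where
    nonvanishing = robust⇒nonvanishing {M = M} robust (s≤s z≤n)
    u : Covectors (suc C ∷ n)
    u zero    = δ zero
    u (suc k) = proj₁ nonvanishing k
    W₀u≢0 : contract ℚ-field (suc d) (suc C ∷ n) (W zero) u ≢ 0ℚ
    W₀u≢0 W₀u≡0 = proj₂ nonvanishing (begin
      contract ℚ-field d n M (u ∘ suc)                      ≡⟨ sym (ℚₚ.*-identityˡ (contract ℚ-field d n M (u ∘ suc))) ⟩
      1ℚ * contract ℚ-field d n M (u ∘ suc)                 ≡⟨ cong (_* contract ℚ-field d n M (u ∘ suc)) (sym (dot-δ (u zero) zero)) ⟩
      dot (u zero) (u zero) * contract ℚ-field d n M (u ∘ suc) ≡⟨ sym (contract-⊗ n (u zero) M u) ⟩
      contract ℚ-field (suc d) (suc C ∷ n) (W zero) u        ≡⟨ W₀u≡0 ⟩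
      0ℚ                                                    ∎)
      where open ≡-Reasoning

  W≢0 : NonzeroSpan ℚ-field (suc C) W
  W≢0 W≡0 = W₀≢0 (W≡0 zero)

  W-IsSR1 : IsSR1 ℚ-field (suc d) (suc C ∷ n) (suc C) W 1
  W-IsSR1 = (W zero , member-inSpanTensor (suc C) W zero , W₀≢0 , W₀-IsSR) , SR≤1
    where
    SR≤1 : ∀ S → InSpanTensor ℚ-field (suc C) W S → ¬ IsZeroTensor ℚ-field S →
           ∀ t → IsSR ℚ-field (suc d) (suc C ∷ n) 1 (λ _ → S) t → t ≤ 1
    SR≤1 S a∈W S≢0 t (_ , minimal) = minimal 1 (SRLe-⊗-hyperplane n M a i₀ ai₀≢0 S (inSpan⇒⊗ a∈W))
      where
      a = proj₁ a∈W
      a≢0 : ¬ (∀ i → a i ≡ 0ℚ)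
      a≢0 a≡0 = S≢0 (λ ι → trans (inSpan⇒⊗ a∈W ι) (trans (cong (_* M (ι ∘ suc)) (a≡0 (ι zero))) (ℚₚ.*-zeroˡ (M (ι ∘ suc)))))
      nonzero-coefficient = Finₚ.¬∀⟶∃¬ (suc C) _ (λ i → a i ℚₚ.≟ 0ℚ) a≢0
      i₀ = proj₁ nonzero-coefficient
      ai₀≢0 = proj₂ nonzero-coefficient

proposition5p13 : (d : ℕ) → 3 ≤ d →
    ¬ (Σ ℕ λ C → C > 0 ×
        ((K : Field) (n : Fin d → ℕ) → (∀ k → 1 ≤ n k) →
         (m : ℕ) (T : Fin m → Tensor K d n) → NonzeroSpan K m T →
         (s t : ℕ) → IsSR K d n m T s → IsSR1 K d n m T t →
         s ≤ C ℕ.* t))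
proposition5p13 (suc e) (s≤s 2≤e) (C , _ , SR≤C·SR₁) =
  ℕₚ.n≮n C (subst (suc C ≤_) (ℕₚ.*-identityʳ C)
    (SR≤C·SR₁ ℚ-field (suc C ∷ dims) dims-pos′ (suc C) W W≢0 (suc C) 1 W-IsSR W-IsSR1))
  where
  open RobustTensor (robustTensor C e 2≤e)
  open Counterexample tensor robust
  dims-pos′ : ∀ k → 1 ≤ (suc C ∷ dims) k
  dims-pos′ zero    = s≤s z≤n
  dims-pos′ (suc k) = dims-pos k
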